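{- Let $m,n$ be positive integers, let $G=K_{m,n}$ be the complete bipartite graph, and let $R$ be the set of all vertices of one part of $G$. Then $$w_R(G)=(m+n-|R|)\cdot\left\lceil\frac{|R|}{m+n-|R|}\right\rceil.$$
   Context: All graphs are finite, undirected, without loops or multiple edges. An interval is a nonempty set of consecutive integers; $[p,q]$ denotes the interval with minimum $p$ and maximum $q$. A proper edge $t$-coloring of a graph $G$ is a function $\varphi:E(G)\to[1,t]$ such that every color in $[1,t]$ is used and no two adjacent edges receive the same color. For a vertex $x$, its spectrum under $\varphi$ is $S_G(x,\varphi)=\{\varphi(e): e\in E(G),\ e \text{ incident with } x\}$. A proper edge coloring $\varphi$ is interval in $x$ if $S_G(x,\varphi)$ is an interval, and interval on a set $R\subseteq V(G)$ if it is interval in every $x\in R$. For a subset $R\subseteq V(G)$ for which some proper edge coloring of $G$ interval on $R$ exists, $w_R(G)$ denotes the minimum $t$ such that there exists a proper edge $t$-coloring of $G$ interval on $R$. -}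

module Defs where

open import Data.Nat using (ℕ; zero; suc; _+_; _*_; _≤_; _/_)
open import Data.Fin using (Fin)
open import Data.Product using (Σ; ∃; ∃-syntax; _×_)
open import Relation.Binary.PropositionalEquality using (_≡_)
open import Function.Bundles using (_⇔_)

-- Ceiling division ⌈ a / b ⌉ (b = 0 is a junk case, never used with b ≥ 1).
⌈_/_⌉ : ℕ → ℕ → ℕ
⌈ a / zero ⌉ = 0
⌈ a / suc k ⌉ = (a + k) / suc k

IsInterval : (ℕ → Set) → Set
IsInterval S = ∃[ p ] ∃[ q ] (p ≤ q × (∀ c → S c ⇔ (p ≤ c × c ≤ q)))

-- The complete bipartite graph K_{m,n} has vertex set Fin m ⊎ Fin n ("left"
-- part X = Fin m, "right" part Y = Fin n) and exactly one edge x y for every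
-- x : Fin m, y : Fin n.
Colouring : ℕ → ℕ → Set
Colouring m n = Fin m → Fin n → ℕ

Proper : ∀ {m n} → Colouring m n → Set
Proper {m} {n} φ =
  (∀ (x : Fin m) (y y′ : Fin n) → φ x y ≡ φ x y′ → y ≡ y′) ×
  (∀ (x x′ : Fin m) (y : Fin n) → φ x y ≡ φ x′ y → x ≡ x′)

IsEdgeColouring : ∀ {m n} → ℕ → Colouring m n → Set
IsEdgeColouring {m} {n} t φ =
  Proper φ ×
  (∀ (x : Fin m) (y : Fin n) → 1 ≤ φ x y × φ x y ≤ t) ×
  (∀ c → 1 ≤ c → c ≤ t → ∃[ x ] ∃[ y ] φ x y ≡ c)

SpectrumLeft : ∀ {m n} → Colouring m n → Fin m → ℕ → Set
SpectrumLeft {m} {n} φ x c = ∃[ y ] φ x y ≡ c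

IntervalOnLeft : ∀ {m n} → Colouring m n → Set
IntervalOnLeft {m} φ = ∀ (x : Fin m) → IsInterval (SpectrumLeft φ x)

wLeftIs : ℕ → ℕ → ℕ → Set
wLeftIs m n t =
  (Σ (Colouring m n) λ φ → IsEdgeColouring t φ × IntervalOnLeft φ) ×
  (∀ t′ (φ : Colouring m n) → IsEdgeColouring t′ φ → IntervalOnLeft φ → t ≤ t′)

module Submission where

-- Write N = n.  Upper bound: split the left vertices into blocks of N
-- consecutive indices; the vertex x in block b colours its edge to y by
-- 1 + b·N + ((y + x) mod N).  Each block is a cyclic Latin square on the
-- colours [b·N + 1, b·N + N], so the colouring is proper, interval at every
-- left vertex, and uses exactly the colours [1, N · ⌈ m / N ⌉].
-- Lower bound: at a left vertex the N colours form an interval of N integers,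
-- which contains a multiple a·N with 1 ≤ a ≤ t / N; as a colour appears at
-- most once at each right vertex, x ↦ (a, y) is injective, so
-- m ≤ (t / N)·N, i.e. ⌈ m / N ⌉ ≤ t / N.

open import Data.Nat using (ℕ; zero; suc; _+_; _*_; _∸_; _≤_; _<_; _/_; _%_; NonZero; z≤n; s≤s; s≤s⁻¹)
open import Data.Nat.Properties
open import Data.Nat.DivMod
open import Data.Nat.Divisibility using (divides-refl)
open import Data.Fin using (Fin; toℕ; fromℕ<; combine)
open import Data.Fin.Properties using (toℕ<n; toℕ-fromℕ<; toℕ-injective; injective⇒≤; combine-injective)
open import Data.Product using (∃-syntax; _×_; _,_; proj₁; proj₂)
open import Data.Empty using (⊥-elim)
open import Function.Bundles using (mk⇔; Equivalence)
open import Relation.Binary.PropositionalEquality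
open import Defs

module Shift (N : ℕ) .{{_ : NonZero N}} where

  quotient-of : ∀ b r → r < N → (r + b * N) / N ≡ b
  quotient-of b r r<N = begin
    (r + b * N) / N    ≡⟨ +-distrib-/-∣ʳ r (divides-refl b) ⟩
    r / N + b * N / N  ≡⟨ cong₂ _+_ (m<n⇒m/n≡0 r<N) (m*n/n≡m b N) ⟩
    b                  ∎
    where open ≡-Reasoning

  remainder-of : ∀ b r → r < N → (r + b * N) % N ≡ r
  remainder-of b r r<N = trans ([m+kn]%n≡m%n r b N) (m<n⇒m%n≡m r<N)

  %-absorbˡ : ∀ a c → (a % N + c) % N ≡ (a + c) % N
  %-absorbˡ a c = begin
    (a % N + c) % N          ≡⟨ %-distribˡ-+ (a % N) c N ⟩
    (a % N % N + c % N) % N  ≡⟨ cong (λ z → (z + c % N) % N) (m%n%n≡m%n a N) ⟩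
    (a % N + c % N) % N      ≡⟨ %-distribˡ-+ a c N ⟨
    (a + c) % N              ∎
    where open ≡-Reasoning

  wrap-around : ∀ a c → a + suc (c / N) * N ≡ (a + c) + (N ∸ c % N)
  wrap-around a c = begin
    a + (N + c / N * N)            ≡⟨ cong (λ z → a + (z + c / N * N)) (m∸n+n≡m (m%n≤n c N)) ⟨
    a + ((e + c % N) + c / N * N)  ≡⟨ cong (a +_) (+-assoc e (c % N) (c / N * N)) ⟩
    a + (e + (c % N + c / N * N))  ≡⟨ cong (λ z → a + (e + z)) (m≡m%n+[m/n]*n c N) ⟨
    a + (e + c)                    ≡⟨ cong (a +_) (+-comm e c) ⟩
    a + (c + e)                    ≡⟨ +-assoc a c e ⟨
    (a + c) + e                    ∎
    where
    open ≡-Reasoning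
    e : ℕ
    e = N ∸ c % N

  shift-cancel : ∀ a b c → (a + c) % N ≡ (b + c) % N → a % N ≡ b % N
  shift-cancel a b c eq = begin
    a % N                        ≡⟨ [m+kn]%n≡m%n a (suc (c / N)) N ⟨
    (a + suc (c / N) * N) % N    ≡⟨ cong (_% N) (wrap-around a c) ⟩
    ((a + c) + e) % N            ≡⟨ %-absorbˡ (a + c) e ⟨
    ((a + c) % N + e) % N        ≡⟨ cong (λ z → (z + e) % N) eq ⟩
    ((b + c) % N + e) % N        ≡⟨ %-absorbˡ (b + c) e ⟩
    ((b + c) + e) % N            ≡⟨ cong (_% N) (wrap-around b c) ⟨
    (b + suc (c / N) * N) % N    ≡⟨ [m+kn]%n≡m%n b (suc (c / N)) N ⟩
    b % N                        ∎
    where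
    open ≡-Reasoning
    e : ℕ
    e = N ∸ c % N

  shift-hit : ∀ c r → r < N → ∃[ y ] (y < N × (y + c) % N ≡ r)
  shift-hit c r r<N = (r + e) % N , m%n<n (r + e) N , (begin
    ((r + e) % N + c) % N        ≡⟨ %-absorbˡ (r + e) c ⟩
    ((r + e) + c) % N            ≡⟨ cong (_% N) (+-assoc r e c) ⟩
    (r + (e + c)) % N            ≡⟨ cong (λ z → (r + z) % N) (+-comm e c) ⟩
    (r + (c + e)) % N            ≡⟨ cong (_% N) (+-assoc r c e) ⟨
    ((r + c) + e) % N            ≡⟨ cong (_% N) (wrap-around r c) ⟨
    (r + suc (c / N) * N) % N    ≡⟨ remainder-of (suc (c / N)) r r<N ⟩
    r                            ∎)
    where
    open ≡-Reasoning
    e : ℕ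
    e = N ∸ c % N

injective-width : ∀ {k p q} (f : Fin k → ℕ) → (∀ {i j} → f i ≡ f j → i ≡ j) →
                  (∀ i → p ≤ f i × f i ≤ q) → k ≤ suc q ∸ p
injective-width {k} {p} {q} f f-injective f-range = injective⇒≤ g-injective
  where
  shifted : ∀ i → f i ∸ p < suc q ∸ p
  shifted i = ∸-monoˡ-< (s≤s (proj₂ (f-range i))) (proj₁ (f-range i))
  g : Fin k → Fin (suc q ∸ p)
  g i = fromℕ< (shifted i)
  g-injective : ∀ {i j} → g i ≡ g j → i ≡ j
  g-injective {i} {j} eq = f-injective (begin
    f i          ≡⟨ m∸n+n≡m (proj₁ (f-range i)) ⟨
    f i ∸ p + p  ≡⟨ cong (_+ p) (trans (sym (toℕ-fromℕ< (shifted i))) (trans (cong toℕ eq) (toℕ-fromℕ< (shifted j)))) ⟩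
    f j ∸ p + p  ≡⟨ m∸n+n≡m (proj₁ (f-range j)) ⟩
    f j          ∎)
    where open ≡-Reasoning

module Ceiling (n' : ℕ) where

  private
    N : ℕ
    N = suc n'

  open Shift N

  ceil-cover : ∀ m → m ≤ ⌈ m / N ⌉ * N
  ceil-cover m = +-cancelʳ-≤ n' m (⌈ m / N ⌉ * N) (begin
    m + n'                                ≡⟨ m≡m%n+[m/n]*n (m + n') N ⟩
    (m + n') % N + ⌈ m / N ⌉ * N          ≤⟨ +-monoˡ-≤ (⌈ m / N ⌉ * N) (s≤s⁻¹ (m%n<n (m + n') N)) ⟩
    n' + ⌈ m / N ⌉ * N                    ≡⟨ +-comm n' _ ⟩
    ⌈ m / N ⌉ * N + n'                    ∎)
    where open ≤-Reasoning

  ceil-least : ∀ m b → m ≤ b * N → ⌈ m / N ⌉ ≤ b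
  ceil-least m b m≤bN = begin
    (m + n') / N      ≤⟨ /-monoˡ-≤ N (+-monoˡ-≤ n' m≤bN) ⟩
    (b * N + n') / N  ≡⟨ cong (_/ N) (+-comm (b * N) n') ⟩
    (n' + b * N) / N  ≡⟨ quotient-of b n' ≤-refl ⟩
    b                 ∎
    where open ≤-Reasoning

  -- An interval [p, q] ⊆ [1, ∞) of at least N integers contains a positive
  -- multiple of N, namely ⌈ p / N ⌉ · N.
  interval-contains-multiple : ∀ p q → 1 ≤ p → n' + p ≤ q →
                               ∃[ a ] (p ≤ suc a * N × suc a * N ≤ q)
  interval-contains-multiple p q 1≤p n'+p≤q =
    positive ⌈ p / N ⌉ (ceil-cover p) (≤-trans (m/n*n≤m (p + n') N) (subst (_≤ q) (+-comm n' p) n'+p≤q))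
    where
    positive : ∀ a → p ≤ a * N → a * N ≤ q → ∃[ a′ ] (p ≤ suc a′ * N × suc a′ * N ≤ q)
    positive zero    p≤0 _ = ⊥-elim (<⇒≱ 1≤p p≤0)
    positive (suc a) p≤aN aN≤q = a , p≤aN , aN≤q

module UpperBound (m n' : ℕ) where

  private
    N : ℕ
    N = suc n'

  open Shift N
  open Ceiling n'

  k : ℕ
  k = ⌈ m / N ⌉

  block : Fin m → ℕ
  block x = toℕ x / N

  offset : Fin m → Fin N → ℕ
  offset x y = (toℕ y + toℕ x) % N

  offset<N : ∀ x y → offset x y < N
  offset<N x y = m%n<n (toℕ y + toℕ x) N

  colouring : Colouring m N
  colouring x y = suc (offset x y + block x * N)

  colour-injective : ∀ x x′ y y′ → colouring x y ≡ colouring x′ y′ →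
                     block x ≡ block x′ × offset x y ≡ offset x′ y′
  colour-injective x x′ y y′ eq =
    trans (sym (quotient-of (block x) (offset x y) (offset<N x y)))
          (trans (cong (_/ N) eq′) (quotient-of (block x′) (offset x′ y′) (offset<N x′ y′))) ,
    trans (sym (remainder-of (block x) (offset x y) (offset<N x y)))
          (trans (cong (_% N) eq′) (remainder-of (block x′) (offset x′ y′) (offset<N x′ y′)))
    where
    eq′ : offset x y + block x * N ≡ offset x′ y′ + block x′ * N
    eq′ = suc-injective eq

  proper : Proper colouring
  proper = at-left , at-right
    where
    at-left : ∀ x y y′ → colouring x y ≡ colouring x y′ → y ≡ y′
    at-left x y y′ eq = toℕ-injective (begin
      toℕ y      ≡⟨ m<n⇒m%n≡m (toℕ<n y) ⟨
      toℕ y % N  ≡⟨ shift-cancel (toℕ y) (toℕ y′) (toℕ x) (proj₂ (colour-injective x x y y′ eq)) ⟩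
      toℕ y′ % N ≡⟨ m<n⇒m%n≡m (toℕ<n y′) ⟩
      toℕ y′     ∎)
      where open ≡-Reasoning
    at-right : ∀ x x′ y → colouring x y ≡ colouring x′ y → x ≡ x′
    at-right x x′ y eq = toℕ-injective (begin
      toℕ x                   ≡⟨ m≡m%n+[m/n]*n (toℕ x) N ⟩
      toℕ x % N + block x * N ≡⟨ cong₂ (λ r b → r + b * N) same-residue same-block ⟩
      toℕ x′ % N + block x′ * N ≡⟨ m≡m%n+[m/n]*n (toℕ x′) N ⟨
      toℕ x′                  ∎)
      where
      open ≡-Reasoning
      same-block : block x ≡ block x′
      same-block = proj₁ (colour-injective x x′ y y eq)
      same-residue : toℕ x % N ≡ toℕ x′ % N
      same-residue = shift-cancel (toℕ x) (toℕ x′) (toℕ y)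
        (trans (cong (_% N) (+-comm (toℕ x) (toℕ y)))
          (trans (proj₂ (colour-injective x x′ y y eq)) (cong (_% N) (+-comm (toℕ y) (toℕ x′)))))

  block<k : ∀ x → block x < k
  block<k x = m<n*o⇒m/o<n (≤-trans (toℕ<n x) (ceil-cover m))

  first-of-block : ∀ b → b < k → b * N < m
  first-of-block b b<k = ≰⇒> (λ m≤bN → <⇒≱ b<k (ceil-least m b m≤bN))

  colours-in-range : ∀ x y → 1 ≤ colouring x y × colouring x y ≤ N * k
  colours-in-range x y = s≤s z≤n , (begin
    suc (offset x y + block x * N)  ≤⟨ +-monoˡ-< (block x * N) (offset<N x y) ⟩
    suc (block x) * N               ≤⟨ *-monoˡ-≤ N (block<k x) ⟩
    k * N                           ≡⟨ *-comm k N ⟩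
    N * k                           ∎)
    where open ≤-Reasoning

  every-colour-used : ∀ c → 1 ≤ c → c ≤ N * k → ∃[ x ] ∃[ y ] colouring x y ≡ c
  every-colour-used (suc c) _ c<Nk = fromℕ< bN<m , fromℕ< r<N , (begin
    suc ((toℕ (fromℕ< r<N) + toℕ (fromℕ< bN<m)) % N + toℕ (fromℕ< bN<m) / N * N)
      ≡⟨ cong₂ (λ i j → suc ((j + i) % N + i / N * N)) (toℕ-fromℕ< bN<m) (toℕ-fromℕ< r<N) ⟩
    suc ((r + b * N) % N + b * N / N * N)
      ≡⟨ cong₂ (λ i j → suc (i + j * N)) (remainder-of b r r<N) (m*n/n≡m b N) ⟩
    suc (r + b * N)
      ≡⟨ cong suc (m≡m%n+[m/n]*n c N) ⟨
    suc c ∎)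
    where
    open ≡-Reasoning
    b r : ℕ
    b = c / N
    r = c % N
    r<N : r < N
    r<N = m%n<n c N
    bN<m : b * N < m
    bN<m = first-of-block b (m<n*o⇒m/o<n (subst (c <_) (*-comm N k) c<Nk))

  interval : IntervalOnLeft colouring
  interval x = suc bN , N + bN , +-monoˡ-≤ bN (s≤s z≤n) , λ c → mk⇔ (to c) (from c)
    where
    bN : ℕ
    bN = block x * N
    to : ∀ c → SpectrumLeft colouring x c → suc bN ≤ c × c ≤ N + bN
    to c (y , refl) = s≤s (m≤n+m bN (offset x y)) , +-monoˡ-< bN (offset<N x y)
    from : ∀ c → suc bN ≤ c × c ≤ N + bN → SpectrumLeft colouring x c
    from (suc c) (s≤s bN≤c , c<N+bN) = y , (begin
      suc (offset x y + bN)  ≡⟨ cong (λ r → suc (r + bN)) hits ⟩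
      suc (c ∸ bN + bN)      ≡⟨ cong suc (m∸n+n≡m bN≤c) ⟩
      suc c                  ∎)
      where
      open ≡-Reasoning
      r<N : c ∸ bN < N
      r<N = +-cancelʳ-< bN (c ∸ bN) N (subst (_< N + bN) (sym (m∸n+n≡m bN≤c)) c<N+bN)
      hit : ∃[ y ] (y < N × (y + toℕ x) % N ≡ c ∸ bN)
      hit = shift-hit (toℕ x) (c ∸ bN) r<N
      y : Fin N
      y = fromℕ< (proj₁ (proj₂ hit))
      hits : offset x y ≡ c ∸ bN
      hits = trans (cong (λ i → (i + toℕ x) % N) (toℕ-fromℕ< (proj₁ (proj₂ hit)))) (proj₂ (proj₂ hit))

  optimal-colouring : IsEdgeColouring (N * k) colouring × IntervalOnLeft colouring
  optimal-colouring = (proper , colours-in-range , every-colour-used) , interval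

module LowerBound (m n' t : ℕ) (φ : Colouring m (suc n'))
                  (edge : IsEdgeColouring t φ) (interval : IntervalOnLeft φ) where

  private
    N : ℕ
    N = suc n'

  open Ceiling n'

  d : ℕ
  d = t / N

  at-left : ∀ x y y′ → φ x y ≡ φ x y′ → y ≡ y′
  at-left = proj₁ (proj₁ edge)

  at-right : ∀ x x′ y → φ x y ≡ φ x′ y → x ≡ x′
  at-right = proj₂ (proj₁ edge)

  in-range : ∀ x y → 1 ≤ φ x y × φ x y ≤ t
  in-range = proj₁ (proj₂ edge)

  multiple-at : ∀ x → ∃[ i ] ∃[ y ] φ x y ≡ suc (toℕ {d} i) * N
  multiple-at x with interval x
  ... | p , q , p≤q , spectrum = fromℕ< a<d , y , trans (proj₂ hit) (cong (λ i → suc i * N) (sym (toℕ-fromℕ< a<d)))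
    where
    inside : ∀ c → p ≤ c → c ≤ q → SpectrumLeft φ x c
    inside c p≤c c≤q = Equivalence.from (spectrum c) (p≤c , c≤q)
    1≤p : 1 ≤ p
    1≤p with inside p ≤-refl p≤q
    ... | y₀ , refl = proj₁ (in-range x y₀)
    q≤t : q ≤ t
    q≤t with inside q p≤q ≤-refl
    ... | y₁ , refl = proj₂ (in-range x y₁)
    width : N ≤ suc q ∸ p
    width = injective-width (φ x) (at-left x _ _) (λ y → Equivalence.to (spectrum (φ x y)) (y , refl))
    n'+p≤q : n' + p ≤ q
    n'+p≤q = s≤s⁻¹ (subst (N + p ≤_) (m∸n+n≡m (≤-trans p≤q (n≤1+n q))) (+-monoˡ-≤ p width))
    multiple : ∃[ a ] (p ≤ suc a * N × suc a * N ≤ q)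
    multiple = interval-contains-multiple p q 1≤p n'+p≤q
    a : ℕ
    a = proj₁ multiple
    a<d : a < d
    a<d = subst (_≤ d) (m*n/n≡m (suc a) N) (/-monoˡ-≤ N (≤-trans (proj₂ (proj₂ multiple)) q≤t))
    hit : SpectrumLeft φ x (suc a * N)
    hit = inside (suc a * N) (proj₁ (proj₂ multiple)) (proj₂ (proj₂ multiple))
    y : Fin N
    y = proj₁ hit

  index : Fin m → Fin d
  index x = proj₁ (multiple-at x)

  witness : Fin m → Fin N
  witness x = proj₁ (proj₂ (multiple-at x))

  witness-colour : ∀ x → φ x (witness x) ≡ suc (toℕ (index x)) * N
  witness-colour x = proj₂ (proj₂ (multiple-at x))

  encode : Fin m → Fin (d * N)
  encode x = combine (index x) (witness x)

  encode-injective : ∀ {x x′} → encode x ≡ encode x′ → x ≡ x′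
  encode-injective {x} {x′} eq = at-right x x′ (witness x) (begin
    φ x (witness x)            ≡⟨ witness-colour x ⟩
    suc (toℕ (index x)) * N    ≡⟨ cong (λ i → suc (toℕ i) * N) same-index ⟩
    suc (toℕ (index x′)) * N   ≡⟨ witness-colour x′ ⟨
    φ x′ (witness x′)          ≡⟨ cong (φ x′) same-witness ⟨
    φ x′ (witness x)           ∎)
    where
    open ≡-Reasoning
    same : index x ≡ index x′ × witness x ≡ witness x′
    same = combine-injective (index x) (witness x) (index x′) (witness x′) eq
    same-index : index x ≡ index x′
    same-index = proj₁ same
    same-witness : witness x ≡ witness x′
    same-witness = proj₂ same

  lower-bound : N * ⌈ m / N ⌉ ≤ t
  lower-bound = begin
    N * ⌈ m / N ⌉  ≤⟨ *-monoʳ-≤ N (ceil-least m d (injective⇒≤ encode-injective)) ⟩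
    N * d          ≡⟨ *-comm N d ⟩
    d * N          ≤⟨ m/n*n≤m t N ⟩
    t              ∎
    where open ≤-Reasoning

theorem4 : ∀ (m n : ℕ) → 1 ≤ m → 1 ≤ n → wLeftIs m n (n * ⌈ m / n ⌉)
theorem4 m zero    _ ()
theorem4 m (suc n') _ _ =
  (UpperBound.colouring m n' , UpperBound.optimal-colouring m n') ,
  λ t φ edge interval → LowerBound.lower-bound m n' t φ edge interval
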